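{- Let $n,k$ be integers with $2\le k\le n-1$ and $k$ prime. Let $v_{n,k}$ be the number of vertices of $G(n)$ contained in some $k$-cycle and $w_{n,k}$ the number of vertices of $G(n)$ contained in some closed $k$-walk. Then $v_{n,k}=w_{n,k}-2$.
   Context: For a sequence of distinct integers $c_1\cdots c_t$, $\mathrm{st}(c_1\cdots c_t)$ is the unique permutation $d_1\cdots d_t$ of $\{1,\dots,t\}$ with $d_i<d_j$ iff $c_i<c_j$. $G(n)$ is the directed multigraph whose vertices are the permutations of $\{1,\dots,n\}$ (one-line notation) and whose edges are the permutations $c_1\cdots c_{n+1}$ of $\{1,\dots,n+1\}$, the edge $c_1\cdots c_{n+1}$ going from $\mathrm{st}(c_1\cdots c_n)$ to $\mathrm{st}(c_2\cdots c_{n+1})$; so there is an edge from $x_1\cdots x_n$ to $w_1\cdots w_n$ iff $\mathrm{st}(x_2\cdots x_n)=\mathrm{st}(w_1\cdots w_{n-1})$. A closed $k$-walk $(v_1,\dots,v_k)$ is a sequence of vertices with an edge from $v_i$ to $v_{i+1}$ for $i<k$ and from $v_k$ to $v_1$; it is a $k$-cycle if $v_1,\dots,v_k$ are pairwise distinct. -}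

module Defs where

open import Data.Nat using (ℕ; zero; suc; _≤_; _<_; _∸_; _<?_)
open import Data.Fin using (Fin)
open import Data.Vec using (Vec; lookup; map; count; init; tail)
open import Data.Product using (Σ; ∃; _×_)
open import Data.List using (List; length)
open import Data.List.Membership.Propositional using (_∈_)
open import Data.List.Relation.Unary.Unique.Propositional using (Unique)
open import Relation.Binary.PropositionalEquality using (_≡_)

-- A permutation of {1,…,n} in one-line notation: a vector of length n whose
-- entries lie in {1,…,n} and are pairwise distinct.
IsPerm : (n : ℕ) → Vec ℕ n → Set
IsPerm n v = (∀ i → 1 ≤ lookup v i × lookup v i ≤ n)
           × (∀ i j → lookup v i ≡ lookup v j → i ≡ j)

st : {t : ℕ} → Vec ℕ t → Vec ℕ t
st c = map (λ a → suc (count (λ b → b <? a) c)) c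

Edge : (n : ℕ) → Vec ℕ n → Vec ℕ n → Set
Edge n x w = Σ (Vec ℕ (suc n)) λ c → IsPerm (suc n) c × st (init c) ≡ x × st (tail c) ≡ w

-- A closed k-walk (v₀,…,v_{k-1}), given as f : ℕ → vertices (only indices < k matter).
ClosedWalk : (n k : ℕ) → (ℕ → Vec ℕ n) → Set
ClosedWalk n k f = (∀ i → suc i < k → Edge n (f i) (f (suc i)))
                 × Edge n (f (k ∸ 1)) (f 0)

Cycle : (n k : ℕ) → (ℕ → Vec ℕ n) → Set
Cycle n k f = ClosedWalk n k f × (∀ i j → i < k → j < k → f i ≡ f j → i ≡ j)

OnClosedWalk : (n k : ℕ) → Vec ℕ n → Set
OnClosedWalk n k x = Σ (ℕ → Vec ℕ n) λ f → ClosedWalk n k f × ∃ λ i → i < k × f i ≡ x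

OnCycle : (n k : ℕ) → Vec ℕ n → Set
OnCycle n k x = Σ (ℕ → Vec ℕ n) λ f → Cycle n k f × ∃ λ i → i < k × f i ≡ x

-- L is a duplicate-free list enumerating exactly the vertices of G(n) satisfying P;
-- hence length L is the number of such vertices.
Enumerates : (n : ℕ) → (Vec ℕ n → Set) → List (Vec ℕ n) → Set
Enumerates n P L = Unique L × (∀ x → (x ∈ L → IsPerm n x × P x) × (IsPerm n x × P x → x ∈ L))

-- An edge x → w of G(n) shifts ascent patterns: w has an ascent at j iff x has one at j + 1.
-- Unroll a closed k-walk f₀ ⋯ f_{k-1} periodically; then the ascent word of f_i is the window
-- starting at i of one k-periodic bit sequence (the first ascent bits along the walk), and
-- since k ≤ n - 1 each vertex determines a full period of it. If f_i = f_j with 0 < j - i < k,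
-- the sequence also has period j - i, which is coprime to the prime k, so it is constant. The
-- only permutations with a constant ascent word are 12⋯n and n⋯21, and both carry loops. Hence
-- a closed k-walk through any other vertex is a k-cycle, while the two monotone permutations lie
-- on closed k-walks (their loops) but on no k-cycle: they are the two vertices counted by w but
-- not by v.
module Submission where

open import Defs
open import Data.Bool using (Bool; true; false; T)
open import Data.Fin using (Fin; toℕ; fromℕ<)
import Data.Fin as Fin
open import Data.Fin.Properties using (toℕ<n; toℕ-injective; fromℕ<-injective)
open import Data.List using (List; []; _∷_; length)
open import Data.List.Membership.Propositional using (_∈_)
open import Data.List.Properties using (length-removeAt′)
open import Data.List.Relation.Binary.Subset.Propositional using (_⊆_)
open import Data.List.Relation.Unary.All using (All)
import Data.List.Relation.Unary.All as All
open import Data.List.Relation.Unary.AllPairs using (_∷_)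
open import Data.List.Relation.Unary.Any using (here; there; index; _─_)
open import Data.List.Relation.Unary.Unique.Propositional using (Unique)
open import Data.Nat
open import Data.Nat.Coprimality using (Coprime; coprime-Bézout; prime⇒coprime)
import Data.Nat.Coprimality as Coprimality
open import Data.Nat.DivMod
  using (_%_; _/_; m%n<n; m≡m%n+[m/n]*n; m<n⇒m%n≡m; n%n≡0; %-congˡ; [m+kn]%n≡m%n)
open import Data.Nat.GCD using (module Bézout)
open import Data.Nat.Primality using (Prime)
open import Data.Nat.Properties
open import Data.Product using (_×_; _,_; proj₁; proj₂)
open import Data.Sum using (_⊎_; inj₁; inj₂)
open import Data.Vec using (Vec; []; _∷_; lookup; map; count; init; tail)
import Data.Vec.Membership.Propositional as Vec
open import Data.Vec.Properties using (count≤n; ≡-dec)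
import Data.Vec.Relation.Unary.Any as VecAny
open import Function using (_∘_; _⇔_; mk⇔; Equivalence)
open import Relation.Binary.Definitions using (tri<; tri≈; tri>)
open import Relation.Binary.PropositionalEquality
open import Relation.Nullary using (¬_; Dec; yes; no; does; contradiction)
open import Relation.Nullary.Decidable using (dec-true; dec-false; does-≡; map′)
open import Relation.Nullary.Reflects using (ofʸ; ofⁿ)

∈-─ : ∀ {A : Set} {x z : A} (ys : List A) (x∈ys : x ∈ ys) → z ∈ ys → z ≢ x → z ∈ (ys ─ x∈ys)
∈-─ (y ∷ ys) (here refl) (here refl) z≢x = contradiction refl z≢x
∈-─ (y ∷ ys) (here refl) (there z∈ys) _  = z∈ys
∈-─ (y ∷ ys) (there _)   (here z≡y)  _   = here z≡y
∈-─ (y ∷ ys) (there x∈ys) (there z∈ys) z≢x = there (∈-─ ys x∈ys z∈ys z≢x)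

unique-⊆⇒length-≤ : ∀ {A : Set} {xs ys : List A} → Unique xs → xs ⊆ ys → length xs ≤ length ys
unique-⊆⇒length-≤ {xs = []}     _                  _   = z≤n
unique-⊆⇒length-≤ {xs = x ∷ xs} {ys} (x∉xs ∷ unique) sub = begin
  suc (length xs)           ≤⟨ s≤s (unique-⊆⇒length-≤ unique xs⊆ys─x) ⟩
  suc (length (ys ─ x∈ys))  ≡⟨ length-removeAt′ ys (index x∈ys) ⟨
  length ys                 ∎
  where
  open ≤-Reasoning
  x∈ys : x ∈ ys
  x∈ys = sub (here refl)
  xs⊆ys─x : xs ⊆ (ys ─ x∈ys)
  xs⊆ys─x z∈xs = ∈-─ ys x∈ys (sub (there z∈xs)) (≢-sym (All.lookup x∉xs z∈xs))

unique-⊆-⊇⇒length-≡ : ∀ {A : Set} {xs ys : List A} → Unique xs → Unique ys →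
                      xs ⊆ ys → ys ⊆ xs → length xs ≡ length ys
unique-⊆-⊇⇒length-≡ xs-unique ys-unique xs⊆ys ys⊆xs =
  ≤-antisym (unique-⊆⇒length-≤ xs-unique xs⊆ys) (unique-⊆⇒length-≤ ys-unique ys⊆xs)

Periodic : {A : Set} → ℕ → (ℕ → A) → Set
Periodic p T = ∀ s q → T (s + q * p) ≡ T s

periodic-step : ∀ {A : Set} {p} {T : ℕ → A} → (∀ s → T (s + p) ≡ T s) → Periodic p T
periodic-step {T = T} step s zero = cong T (+-identityʳ s)
periodic-step {p = p} {T} step s (suc q) = begin
  T (s + (p + q * p))  ≡⟨ cong T (trans (cong (s +_) (+-comm p (q * p))) (sym (+-assoc s (q * p) p))) ⟩
  T (s + q * p + p)    ≡⟨ step (s + q * p) ⟩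
  T (s + q * p)        ≡⟨ periodic-step step s q ⟩
  T s                  ∎
  where open ≡-Reasoning

periodic-shift : ∀ {A : Set} {p} {T : ℕ → A} d → Periodic p T → Periodic p (λ s → T (s + d))
periodic-shift {p = p} {T} d per s q = trans (cong T shuffle) (per (s + d) q)
  where
  shuffle : s + q * p + d ≡ s + d + q * p
  shuffle = trans (+-assoc s (q * p) d) (trans (cong (s +_) (+-comm (q * p) d)) (sym (+-assoc s d (q * p))))

periodic-agree : ∀ {A : Set} {K} .{{_ : NonZero K}} {T U : ℕ → A} → Periodic K T → Periodic K U →
                 ∀ a → (∀ {j} → j < K → T (a + j) ≡ U (a + j)) → ∀ s → T s ≡ U s
periodic-agree {K = K} {T} {U} perT perU a agree s = begin
  T s                ≡⟨ perT s a ⟨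
  T (s + a * K)      ≡⟨ cong T window ⟩
  T (a + r + q * K)  ≡⟨ perT (a + r) q ⟩
  T (a + r)          ≡⟨ agree (m%n<n m K) ⟩
  U (a + r)          ≡⟨ perU (a + r) q ⟨
  U (a + r + q * K)  ≡⟨ cong U window ⟨
  U (s + a * K)      ≡⟨ perU s a ⟩
  U s                ∎
  where
  open ≡-Reasoning
  m r q : ℕ
  m = s + a * K ∸ a
  r = m % K
  q = m / K
  window : s + a * K ≡ a + r + q * K
  window = begin
    s + a * K      ≡⟨ m+[n∸m]≡n (≤-trans (m≤m*n a K) (m≤n+m (a * K) s)) ⟨
    a + m          ≡⟨ cong (a +_) (m≡m%n+[m/n]*n m K) ⟩
    a + (r + q * K) ≡⟨ +-assoc a r (q * K) ⟨
    a + r + q * K  ∎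

coprime-periods⇒constant : ∀ {A : Set} {d K} {T : ℕ → A} → Coprime d K →
                           Periodic d T → Periodic K T → ∀ s → T s ≡ T 0
coprime-periods⇒constant {d = d} {K} {T} coprime perd perK = constant
  where
  open ≡-Reasoning
  step : ∀ s → T (suc s) ≡ T s
  step s with coprime-Bézout coprime
  ... | Bézout.+- x y eq = begin
    T (suc s)              ≡⟨ perK (suc s) y ⟨
    T (suc (s + y * K))    ≡⟨ cong T (+-suc s (y * K)) ⟨
    T (s + suc (y * K))    ≡⟨ cong (λ e → T (s + e)) eq ⟩
    T (s + x * d)          ≡⟨ perd s x ⟩
    T s                    ∎
  ... | Bézout.-+ x y eq = begin
    T (suc s)              ≡⟨ perd (suc s) x ⟨
    T (suc (s + x * d))    ≡⟨ cong T (+-suc s (x * d)) ⟨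
    T (s + suc (x * d))    ≡⟨ cong (λ e → T (s + e)) eq ⟩
    T (s + y * K)          ≡⟨ perK s y ⟩
    T s                    ∎
  constant : ∀ s → T s ≡ T 0
  constant zero    = refl
  constant (suc s) = trans (step s) (constant s)

[1+m]%n≡[1+m%n]%n : ∀ m n .{{_ : NonZero n}} → suc m % n ≡ suc (m % n) % n
[1+m]%n≡[1+m%n]%n m n =
  trans (%-congˡ (cong suc (m≡m%n+[m/n]*n m n))) ([m+kn]%n≡m%n (suc (m % n)) (m / n) n)

unroll : {A : Set} (K : ℕ) .{{_ : NonZero K}} → (ℕ → A) → ℕ → A
unroll K f s = f (s % K)

unroll-periodic : ∀ {A : Set} K .{{_ : NonZero K}} (f : ℕ → A) → Periodic K (unroll K f)
unroll-periodic K f s q = cong f ([m+kn]%n≡m%n s q K)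

InRange : ℕ → (ℕ → ℕ) → Set
InRange n f = ∀ {j} → j < n → 1 ≤ f j × f j ≤ n

InjectiveOn : ℕ → (ℕ → ℕ) → Set
InjectiveOn n f = ∀ {j l} → j < n → l < n → f j ≡ f l → j ≡ l

increasing⇒≡suc : ∀ {n} (f : ℕ → ℕ) → InRange n f →
                  (∀ {j} → suc j < n → f j < f (suc j)) → ∀ {j} → j < n → f j ≡ suc j
increasing⇒≡suc {n} f bounded increasing {j} j<n = ≤-antisym upper lower
  where
  open ≤-Reasoning
  grow : ∀ m {i} → i + m < n → f i + m ≤ f (i + m)
  grow zero    {i} _ rewrite +-identityʳ i | +-identityʳ (f i) = ≤-refl
  grow (suc m) {i} i+1+m<n = begin
    f i + suc m       ≡⟨ +-suc (f i) m ⟩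
    suc (f i + m)     ≤⟨ s≤s (grow m (<-trans (n<1+n _) 1+i+m<n)) ⟩
    suc (f (i + m))   ≤⟨ increasing 1+i+m<n ⟩
    f (suc (i + m))   ≡⟨ cong f (+-suc i m) ⟨
    f (i + suc m)     ∎
    where
    1+i+m<n : suc (i + m) < n
    1+i+m<n = subst (_< n) (+-suc i m) i+1+m<n
  lower : suc j ≤ f j
  lower = begin
    1 + j     ≤⟨ +-monoˡ-≤ j (proj₁ (bounded (≤-<-trans z≤n j<n))) ⟩
    f 0 + j   ≤⟨ grow j j<n ⟩
    f j       ∎
  rest : ℕ
  rest = n ∸ suc j
  j+rest<n : j + rest < n
  j+rest<n = ≤-reflexive (m+[n∸m]≡n j<n)
  upper : f j ≤ suc j
  upper = +-cancelʳ-≤ rest (f j) (suc j) (begin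
    f j + rest        ≤⟨ grow rest j+rest<n ⟩
    f (j + rest)      ≤⟨ proj₂ (bounded j+rest<n) ⟩
    n                 ≡⟨ m+[n∸m]≡n j<n ⟨
    suc j + rest      ∎)

decreasing⇒≡∸ : ∀ {n} (f : ℕ → ℕ) → InRange n f →
              (∀ {j} → suc j < n → f (suc j) < f j) → ∀ {j} → j < n → f j ≡ n ∸ j
decreasing⇒≡∸ {n} f bounded decreasing {j} j<n = begin
  f j                         ≡⟨ m+n∸n≡m (f j) (suc j) ⟨
  f j + suc j ∸ suc j         ≡⟨ cong (λ a → f j + a ∸ suc j) (reflected j<n) ⟨
  f j + g j ∸ suc j           ≡⟨ cong (_∸ suc j) (m+[n∸m]≡n (f≤1+n j<n)) ⟩
  suc n ∸ suc j               ∎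
  where
  open ≡-Reasoning
  -- Reflecting through n + 1 turns f into an increasing sequence.
  g : ℕ → ℕ
  g i = suc n ∸ f i
  f≤1+n : ∀ {i} → i < n → f i ≤ suc n
  f≤1+n i<n = m≤n⇒m≤1+n (proj₂ (bounded i<n))
  g-bounded : InRange n g
  g-bounded i<n = m<n⇒0<n∸m (s≤s (proj₂ (bounded i<n))) , ∸-monoʳ-≤ (suc n) (proj₁ (bounded i<n))
  reflected : ∀ {i} → i < n → g i ≡ suc i
  reflected = increasing⇒≡suc g g-bounded
    (λ 1+i<n → ∸-monoʳ-< (decreasing 1+i<n) (f≤1+n (<-trans (n<1+n _) 1+i<n)))

-- Vectors indexed by ℕ; positions ≥ t give the junk value 0, so every lemma guards indices by j < t.

at : ∀ {t} → Vec ℕ t → ℕ → ℕ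
at []      _       = 0
at (a ∷ v) zero    = a
at (a ∷ v) (suc j) = at v j

lookup-fromℕ< : ∀ {t j} (v : Vec ℕ t) (j<t : j < t) → lookup v (fromℕ< j<t) ≡ at v j
lookup-fromℕ< {j = zero}  (a ∷ v) _         = refl
lookup-fromℕ< {j = suc j} (a ∷ v) (s≤s j<t) = lookup-fromℕ< v j<t

at-toℕ : ∀ {t} (v : Vec ℕ t) (i : Fin t) → at v (toℕ i) ≡ lookup v i
at-toℕ (a ∷ v) Fin.zero    = refl
at-toℕ (a ∷ v) (Fin.suc i) = at-toℕ v i

at-map : ∀ {t j} (f : ℕ → ℕ) (v : Vec ℕ t) → j < t → at (map f v) j ≡ f (at v j)
at-map {j = zero}  f (a ∷ v) _         = refl
at-map {j = suc j} f (a ∷ v) (s≤s j<t) = at-map f v j<t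

at-init : ∀ {t j} (c : Vec ℕ (suc t)) → j < t → at (init c) j ≡ at c j
at-init {suc t} {zero}  (a ∷ c) _         = refl
at-init {suc t} {suc j} (a ∷ c) (s≤s j<t) = at-init c j<t

at-∈ : ∀ {t j} (v : Vec ℕ t) → j < t → at v j Vec.∈ v
at-∈ {j = zero}  (a ∷ v) _         = VecAny.here refl
at-∈ {j = suc j} (a ∷ v) (s≤s j<t) = VecAny.there (at-∈ v j<t)

at-ext : ∀ {t} (u v : Vec ℕ t) → (∀ j → j < t → at u j ≡ at v j) → u ≡ v
at-ext []      []      _ = refl
at-ext (a ∷ u) (b ∷ v) h = cong₂ _∷_ (h 0 z<s) (at-ext u v (λ j j<t → h (suc j) (s<s j<t)))

tabulateℕ : (t : ℕ) → (ℕ → ℕ) → Vec ℕ t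
tabulateℕ zero    f = []
tabulateℕ (suc t) f = f 0 ∷ tabulateℕ t (f ∘ suc)

at-tabulateℕ : ∀ {t j} (f : ℕ → ℕ) → j < t → at (tabulateℕ t f) j ≡ f j
at-tabulateℕ {j = zero}  f z<s       = refl
at-tabulateℕ {j = suc j} f (s<s j<t) = at-tabulateℕ (f ∘ suc) j<t

IsPermAt : (t : ℕ) → Vec ℕ t → Set
IsPermAt t v = InRange t (at v) × InjectiveOn t (at v)

isPerm⇒isPermAt : ∀ {t} (v : Vec ℕ t) → IsPerm t v → IsPermAt t v
isPerm⇒isPermAt {t} v (range , inj) =
    (λ j<t → subst (λ a → 1 ≤ a × a ≤ t) (lookup-fromℕ< v j<t) (range (fromℕ< j<t)))
  , (λ {j} {l} j<t l<t eq → fromℕ<-injective j l j<t l<t (inj _ _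
      (trans (lookup-fromℕ< v j<t) (trans eq (sym (lookup-fromℕ< v l<t))))))

isPermAt⇒isPerm : ∀ {t} (v : Vec ℕ t) → IsPermAt t v → IsPerm t v
isPermAt⇒isPerm {t} v (range , inj) =
    (λ i → subst (λ a → 1 ≤ a × a ≤ t) (at-toℕ v i) (range (toℕ<n i)))
  , (λ i i′ eq → toℕ-injective (inj (toℕ<n i) (toℕ<n i′)
      (trans (at-toℕ v i) (trans eq (sym (at-toℕ v i′))))))

init-injective : ∀ {t} (c : Vec ℕ (suc t)) → InjectiveOn (suc t) (at c) → InjectiveOn t (at (init c))
init-injective c inj j<t l<t eq =
  inj (<-trans j<t (n<1+n _)) (<-trans l<t (n<1+n _)) (trans (sym (at-init c j<t)) (trans eq (at-init c l<t)))

tail-injective : ∀ {t} (c : Vec ℕ (suc t)) → InjectiveOn (suc t) (at c) → InjectiveOn t (at (tail c))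
tail-injective (a ∷ c) inj j<t l<t eq = suc-injective (inj (s<s j<t) (s<s l<t) eq)

rank : ∀ {t} → ℕ → Vec ℕ t → ℕ
rank a v = count (_<? a) v

rank-mono : ∀ {t a b} → a ≤ b → (v : Vec ℕ t) → rank a v ≤ rank b v
rank-mono a≤b [] = z≤n
rank-mono {a = a} {b} a≤b (x ∷ v) with x <ᵇ a | <ᵇ-reflects-< x a | x <ᵇ b | <ᵇ-reflects-< x b
... | true  | ofʸ _   | true  | _        = s≤s (rank-mono a≤b v)
... | true  | ofʸ x<a | false | ofⁿ x≮b  = contradiction (<-≤-trans x<a a≤b) x≮b
... | false | _       | true  | _        = m≤n⇒m≤1+n (rank-mono a≤b v)
... | false | _       | false | _        = rank-mono a≤b v

rank-< : ∀ {t a b} → a < b → (v : Vec ℕ t) → a Vec.∈ v → rank a v < rank b v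
rank-< {a = a} {b} a<b (x ∷ v) a∈ with x <ᵇ a | <ᵇ-reflects-< x a | x <ᵇ b | <ᵇ-reflects-< x b | a∈
... | true  | ofʸ x<a | _     | _       | VecAny.here refl = contradiction x<a (<-irrefl refl)
... | true  | _       | true  | _       | VecAny.there a∈v = s≤s (rank-< a<b v a∈v)
... | true  | ofʸ x<a | false | ofⁿ x≮b | VecAny.there _   = contradiction (<-trans x<a a<b) x≮b
... | false | _       | true  | _       | _                = s≤s (rank-mono (<⇒≤ a<b) v)
... | false | _       | false | ofⁿ x≮b | VecAny.here refl = contradiction a<b x≮b
... | false | _       | false | _       | VecAny.there a∈v = rank-< a<b v a∈v

at-st : ∀ {t j} (v : Vec ℕ t) → j < t → at (st v) j ≡ suc (rank (at v j) v)
at-st v = at-map _ v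

st-<⇔ : ∀ {t j l} (v : Vec ℕ t) → j < t → l < t → (at v j < at v l) ⇔ (at (st v) j < at (st v) l)
st-<⇔ {j = j} {l} v j<t l<t rewrite at-st v j<t | at-st v l<t = mk⇔
  (λ lt → s≤s (rank-< lt v (at-∈ v j<t)))
  (λ lt → ≰⇒> (λ ge → <⇒≱ lt (s≤s (rank-mono ge v))))

st-isPermAt : ∀ {t} (v : Vec ℕ t) → InjectiveOn t (at v) → IsPermAt t (st v)
st-isPermAt {t} v inj = range , injective
  where
  range : InRange t (at (st v))
  range {j} j<t rewrite at-st v j<t =
    s≤s z≤n , <-≤-trans (rank-< (n<1+n _) v (at-∈ v j<t)) (count≤n _ v)
  injective : InjectiveOn t (at (st v))
  injective {j} {l} j<t l<t eq with <-cmp (at v j) (at v l)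
  ... | tri< lt _ _ = contradiction eq (<⇒≢ (Equivalence.to (st-<⇔ v j<t l<t) lt))
  ... | tri≈ _ eq′ _ = inj j<t l<t eq′
  ... | tri> _ _ gt = contradiction (sym eq) (<⇒≢ (Equivalence.to (st-<⇔ v l<t j<t) gt))

does-⇔ : ∀ {A B : Set} → A ⇔ B → (a? : Dec A) (b? : Dec B) → does a? ≡ does b?
does-⇔ A⇔B a? b? = does-≡ a? (map′ (Equivalence.from A⇔B) (Equivalence.to A⇔B) b?)

ascent : ∀ {t} → Vec ℕ t → ℕ → Bool
ascent v j = does (at v j <? at v (suc j))

-- does (m <? n) computes to m <ᵇ n.
ascent-true⇒< : ∀ {t j} (v : Vec ℕ t) → ascent v j ≡ true → at v j < at v (suc j)
ascent-true⇒< v eq = <ᵇ⇒< _ _ (subst T (sym eq) _)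

ascent-false⇒≮ : ∀ {t j} (v : Vec ℕ t) → ascent v j ≡ false → ¬ at v j < at v (suc j)
ascent-false⇒≮ v eq lt = subst T eq (<⇒<ᵇ lt)

ascent-st : ∀ {t j} (v : Vec ℕ t) → suc j < t → ascent (st v) j ≡ ascent v j
ascent-st {j = j} v 1+j<t = sym (does-⇔ (st-<⇔ v (<-trans (n<1+n _) 1+j<t) 1+j<t)
  (at v j <? at v (suc j)) (at (st v) j <? at (st v) (suc j)))

ascent-init : ∀ {t j} (c : Vec ℕ (suc t)) → suc j < t → ascent (init c) j ≡ ascent c j
ascent-init c 1+j<t
  rewrite at-init c (<-trans (n<1+n _) 1+j<t) | at-init c 1+j<t = refl

ascent-tail : ∀ {t} (c : Vec ℕ (suc t)) j → ascent (tail c) j ≡ ascent c (suc j)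
ascent-tail (a ∷ c) j = refl

edge-ascent : ∀ {n x w j} → Edge n x w → suc (suc j) < n → ascent w j ≡ ascent x (suc j)
edge-ascent {j = j} (c , _ , refl , refl) 2+j<n = begin
  ascent (st (tail c)) j        ≡⟨ ascent-st (tail c) (<-trans (n<1+n _) 2+j<n) ⟩
  ascent (tail c) j             ≡⟨ ascent-tail c j ⟩
  ascent c (suc j)              ≡⟨ ascent-init c 2+j<n ⟨
  ascent (init c) (suc j)       ≡⟨ ascent-st (init c) 2+j<n ⟨
  ascent (st (init c)) (suc j)  ∎
  where open ≡-Reasoning

edge-target-isPermAt : ∀ {n x w} → Edge n x w → IsPermAt n w
edge-target-isPermAt (c , c-perm , _ , refl) =
  st-isPermAt (tail c) (tail-injective c (proj₂ (isPerm⇒isPermAt c c-perm)))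

monotoneFun : ℕ → Bool → ℕ → ℕ
monotoneFun t true  j = suc j
monotoneFun t false j = t ∸ j

monotone : (t : ℕ) → Bool → Vec ℕ t
monotone t b = tabulateℕ t (monotoneFun t b)

at-monotone : ∀ {t j} b → j < t → at (monotone t b) j ≡ monotoneFun t b j
at-monotone b = at-tabulateℕ (monotoneFun _ b)

monotone-isPermAt : ∀ t b → IsPermAt t (monotone t b)
monotone-isPermAt t b = range b , injective b
  where
  range : ∀ b → InRange t (at (monotone t b))
  range true  j<t rewrite at-monotone true j<t = s≤s z≤n , j<t
  range false {j} j<t rewrite at-monotone false j<t = m<n⇒0<n∸m j<t , m∸n≤m t j
  injective : ∀ b → InjectiveOn t (at (monotone t b))
  injective true j<t l<t eq
    rewrite at-monotone true j<t | at-monotone true l<t = suc-injective eq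
  injective false j<t l<t eq
    rewrite at-monotone false j<t | at-monotone false l<t = ∸-cancelˡ-≡ (<⇒≤ j<t) (<⇒≤ l<t) eq

monotone-isPerm : ∀ t b → IsPerm t (monotone t b)
monotone-isPerm t b = isPermAt⇒isPerm (monotone t b) (monotone-isPermAt t b)

monotone-ascent : ∀ {t j} b → suc j < t → ascent (monotone t b) j ≡ b
monotone-ascent {t} {j} b 1+j<t
  rewrite at-monotone b (<-trans (n<1+n _) 1+j<t) | at-monotone b 1+j<t = ascentFun b
  where
  ascentFun : ∀ b → does (monotoneFun t b j <? monotoneFun t b (suc j)) ≡ b
  ascentFun true  = dec-true (suc j <? suc (suc j)) (n<1+n _)
  ascentFun false = dec-false (t ∸ j <? t ∸ suc j) (<⇒≱ (∸-monoʳ-< (n<1+n j) (<⇒≤ 1+j<t)) ∘ <⇒≤)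

ascending≢descending : ∀ {n} → 1 < n → monotone n true ≢ monotone n false
ascending≢descending {n} 1<n eq =
  <⇒≢ 1<n (trans (sym (at-monotone true 0<n)) (trans (cong (λ v → at v 0) eq) (at-monotone false 0<n)))
  where
  0<n : 0 < n
  0<n = <-trans z<s 1<n

constantAscents⇒monotone : ∀ {t} {v : Vec ℕ t} b → IsPermAt t v →
                           (∀ {j} → suc j < t → ascent v j ≡ b) → v ≡ monotone t b
constantAscents⇒monotone {t} {v} b (range , inj) asc =
  at-ext v (monotone t b) (λ j j<t → trans (entries b asc j<t) (sym (at-monotone b j<t)))
  where
  entries : ∀ b → (∀ {j} → suc j < t → ascent v j ≡ b) → ∀ {j} → j < t → at v j ≡ monotoneFun t b j
  entries true  asc = increasing⇒≡suc (at v) range (λ 1+j<t → ascent-true⇒< v (asc 1+j<t))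
  entries false asc = decreasing⇒≡∸ (at v) range (λ {j} 1+j<t →
    ≤∧≢⇒< (≮⇒≥ (ascent-false⇒≮ v (asc 1+j<t)))
          (λ eq → 1+n≢n (inj 1+j<t (<-trans (n<1+n j) 1+j<t) eq)))

st-constantAscents : ∀ {t} (v : Vec ℕ t) b → InjectiveOn t (at v) →
                     (∀ {j} → suc j < t → ascent v j ≡ b) → st v ≡ monotone t b
st-constantAscents v b inj asc =
  constantAscents⇒monotone b (st-isPermAt v inj) (λ 1+j<t → trans (ascent-st v 1+j<t) (asc 1+j<t))

monotone-loop : ∀ n b → Edge n (monotone n b) (monotone n b)
monotone-loop n b = c , monotone-isPerm (suc n) b ,
    st-constantAscents (init c) b (init-injective c (proj₂ c-perm))
      (λ 1+j<n → trans (ascent-init c 1+j<n) (monotone-ascent b (<-trans 1+j<n (n<1+n _)))) ,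
    st-constantAscents (tail c) b (tail-injective c (proj₂ c-perm))
      (λ {j} 1+j<n → trans (ascent-tail c j) (monotone-ascent b (s<s 1+j<n)))
  where
  c : Vec ℕ (suc n)
  c = monotone (suc n) b
  c-perm : IsPermAt (suc n) c
  c-perm = monotone-isPermAt (suc n) b

InfiniteWalk : (n : ℕ) → (ℕ → Vec ℕ n) → Set
InfiniteWalk n g = ∀ s → Edge n (g s) (g (suc s))

infiniteWalk-ascent : ∀ {n g} → InfiniteWalk n g →
                      ∀ i j → suc j < n → ascent (g i) j ≡ ascent (g (j + i)) 0
infiniteWalk-ascent walk i zero    _     = refl
infiniteWalk-ascent {g = g} walk i (suc j) 2+j<n = begin
  ascent (g i) (suc j)      ≡⟨ edge-ascent (walk i) 2+j<n ⟨
  ascent (g (suc i)) j      ≡⟨ infiniteWalk-ascent walk (suc i) j (<-trans (n<1+n _) 2+j<n) ⟩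
  ascent (g (j + suc i)) 0  ≡⟨ cong (λ s → ascent (g s) 0) (+-suc j i) ⟩
  ascent (g (suc j + i)) 0  ∎
  where open ≡-Reasoning

unroll-closedWalk : ∀ {n K f} .{{_ : NonZero K}} → ClosedWalk n K f → InfiniteWalk n (unroll K f)
unroll-closedWalk {n} {K} {f} (steps , closing) s with suc (s % K) <? K
... | yes 1+r<K = subst (Edge n (f (s % K)) ∘ f) (sym 1+s%K≡1+r) (steps (s % K) 1+r<K)
  where
  1+s%K≡1+r : suc s % K ≡ suc (s % K)
  1+s%K≡1+r = trans ([1+m]%n≡[1+m%n]%n s K) (m<n⇒m%n≡m 1+r<K)
... | no 1+r≮K = subst₂ (Edge n) (cong f (sym s%K≡K-1)) (cong f (sym 1+s%K≡0)) closing
  where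
  1+r≡K : suc (s % K) ≡ K
  1+r≡K = ≤∧≮⇒≡ (m%n<n s K) 1+r≮K
  1+s%K≡0 : suc s % K ≡ 0
  1+s%K≡0 = trans ([1+m]%n≡[1+m%n]%n s K) (trans (cong (_% K) 1+r≡K) (n%n≡0 K))
  s%K≡K-1 : s % K ≡ K ∸ 1
  s%K≡K-1 = cong pred 1+r≡K

module ClosedWalkAscents {n K : ℕ} .{{_ : NonZero K}} (K<n : K < n)
                         {f : ℕ → Vec ℕ n} (walk : ClosedWalk n K f) where

  -- The ascent word of the i-th vertex is the window of signature starting at i.
  signature : ℕ → Bool
  signature s = ascent (unroll K f s) 0

  signature-periodic : Periodic K signature
  signature-periodic s q = cong (λ v → ascent v 0) (unroll-periodic K f s q)

  vertex-ascent : ∀ {i j} → i < K → suc j < n → ascent (f i) j ≡ signature (j + i)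
  vertex-ascent {i} {j} i<K 1+j<n = begin
    ascent (f i) j               ≡⟨ cong (λ r → ascent (f r) j) (m<n⇒m%n≡m i<K) ⟨
    ascent (unroll K f i) j      ≡⟨ infiniteWalk-ascent (unroll-closedWalk walk) i j 1+j<n ⟩
    signature (j + i)            ∎
    where open ≡-Reasoning

  window-ascent : ∀ {i j} → i < K → j < K → ascent (f i) j ≡ signature (i + j)
  window-ascent {i} {j} i<K j<K =
    trans (vertex-ascent i<K (<-≤-trans (s<s j<K) K<n)) (cong signature (+-comm j i))

  vertex-isPermAt : ∀ {i} → i < K → IsPermAt n (f i)
  vertex-isPermAt {zero}  _     = edge-target-isPermAt (proj₂ walk)
  vertex-isPermAt {suc i} 1+i<K = edge-target-isPermAt (proj₁ walk i 1+i<K)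

  constantSignature⇒monotone : ∀ b → (∀ s → signature s ≡ b) → ∀ {i} → i < K → f i ≡ monotone n b
  constantSignature⇒monotone b const {i} i<K =
    constantAscents⇒monotone b (vertex-isPermAt i<K)
      (λ {j} 1+j<n → trans (vertex-ascent i<K 1+j<n) (const (j + i)))

  monotoneVertex⇒constantSignature : ∀ b {i} → i < K → f i ≡ monotone n b → ∀ s → signature s ≡ b
  monotoneVertex⇒constantSignature b {i} i<K fi≡ =
    periodic-agree signature-periodic (λ _ _ → refl) i (λ {j} j<K → begin
      signature (i + j)            ≡⟨ window-ascent i<K j<K ⟨
      ascent (f i) j               ≡⟨ cong (λ v → ascent v j) fi≡ ⟩
      ascent (monotone n b) j      ≡⟨ monotone-ascent b (<-≤-trans (s<s j<K) K<n) ⟩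
      b                            ∎)
    where open ≡-Reasoning

  repeatedVertex⇒periodic : ∀ {i j} → i < j → j < K → f i ≡ f j → Periodic (j ∸ i) signature
  repeatedVertex⇒periodic {i} {j} i<j j<K fi≡fj = periodic-step λ s →
    sym (periodic-agree signature-periodic (periodic-shift d signature-periodic) i agree s)
    where
    open ≡-Reasoning
    d : ℕ
    d = j ∸ i
    agree : ∀ {t} → t < K → signature (i + t) ≡ signature (i + t + d)
    agree {t} t<K = begin
      signature (i + t)      ≡⟨ window-ascent (<-trans i<j j<K) t<K ⟨
      ascent (f i) t         ≡⟨ cong (λ v → ascent v t) fi≡fj ⟩
      ascent (f j) t         ≡⟨ window-ascent j<K t<K ⟩
      signature (j + t)      ≡⟨ cong signature (begin
        j + t                  ≡⟨ cong (_+ t) (m+[n∸m]≡n (<⇒≤ i<j)) ⟨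
        i + d + t              ≡⟨ +-assoc i d t ⟩
        i + (d + t)            ≡⟨ cong (i +_) (+-comm d t) ⟩
        i + (t + d)            ≡⟨ +-assoc i t d ⟨
        i + t + d              ∎) ⟩
      signature (i + t + d)  ∎

onCycle⇒onClosedWalk : ∀ {n K x} → OnCycle n K x → OnClosedWalk n K x
onCycle⇒onClosedWalk (f , (walk , _) , on) = f , walk , on

monotone-onClosedWalk : ∀ {n K} b → 0 < K → OnClosedWalk n K (monotone n b)
monotone-onClosedWalk {n} b 0<K =
  (λ _ → monotone n b) , ((λ _ _ → monotone-loop n b) , monotone-loop n b) , 0 , 0<K , refl

monotone-not-onCycle : ∀ {n K} b → 2 ≤ K → K < n → ¬ OnCycle n K (monotone n b)
monotone-not-onCycle {n} {K@(suc _)} b 2≤K K<n (f , (walk , distinct) , i , i<K , fi≡) =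
  0≢1+n (distinct 0 1 z<s 2≤K (trans (monotoneVertex z<s) (sym (monotoneVertex 2≤K))))
  where
  open ClosedWalkAscents K<n walk
  monotoneVertex : ∀ {r} → r < K → f r ≡ monotone n b
  monotoneVertex = constantSignature⇒monotone b (monotoneVertex⇒constantSignature b i<K fi≡)

closedWalk-avoidingMonotone⇒onCycle : ∀ {n K x} → Prime K → K < n → OnClosedWalk n K x →
                                      (∀ b → x ≢ monotone n b) → OnCycle n K x
closedWalk-avoidingMonotone⇒onCycle {n} {K@(suc _)} K-prime K<n (f , walk , t , t<K , ft≡x) nonMonotone =
  f , (walk , distinct) , t , t<K , ft≡x
  where
  open ClosedWalkAscents K<n walk
  no-repeat : ∀ {i j} → i < j → j < K → f i ≢ f j
  no-repeat {i} {j} i<j j<K fi≡fj =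
    nonMonotone (signature 0) (trans (sym ft≡x) (constantSignature⇒monotone (signature 0) constant t<K))
    where
    coprime : Coprime (j ∸ i) K
    coprime = Coprimality.sym
      (prime⇒coprime K-prime {{>-nonZero (m<n⇒0<n∸m i<j)}} (≤-<-trans (m∸n≤m j i) j<K))
    constant : ∀ s → signature s ≡ signature 0
    constant = coprime-periods⇒constant coprime (repeatedVertex⇒periodic i<j j<K fi≡fj) signature-periodic
  distinct : ∀ i j → i < K → j < K → f i ≡ f j → i ≡ j
  distinct i j i<K j<K eq with <-cmp i j
  ... | tri< i<j _ _ = contradiction eq (no-repeat i<j j<K)
  ... | tri≈ _ i≡j _ = i≡j
  ... | tri> _ _ j<i = contradiction (sym eq) (no-repeat j<i i<K)

onClosedWalk⇒monotone⊎onCycle : ∀ {n K x} → Prime K → K < n → OnClosedWalk n K x →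
                                x ≡ monotone n true ⊎ x ≡ monotone n false ⊎ OnCycle n K x
onClosedWalk⇒monotone⊎onCycle {n} {x = x} K-prime K<n onWalk
  with ≡-dec _≟_ x (monotone n true) | ≡-dec _≟_ x (monotone n false)
... | yes x≡asc | _         = inj₁ x≡asc
... | no _      | yes x≡dsc = inj₂ (inj₁ x≡dsc)
... | no x≢asc  | no x≢dsc  =
  inj₂ (inj₂ (closedWalk-avoidingMonotone⇒onCycle K-prime K<n onWalk nonMonotone))
  where
  nonMonotone : ∀ b → x ≢ monotone n b
  nonMonotone true  = x≢asc
  nonMonotone false = x≢dsc

corollary5p5 : (n k : ℕ) → 2 ≤ k → suc k ≤ n → Prime k →
    (V W : List (Vec ℕ n)) →
    Enumerates n (OnCycle n k) V → Enumerates n (OnClosedWalk n k) W →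
    length V + 2 ≡ length W
corollary5p5 n k 2≤k k<n k-prime V W (V-unique , V-enum) (W-unique , W-enum) =
  trans (+-comm (length V) 2) (unique-⊆-⊇⇒length-≡ L-unique W-unique L⊆W W⊆L)
  where
  0<k : 0 < k
  0<k = <-trans z<s 2≤k
  L : List (Vec ℕ n)
  L = monotone n true ∷ monotone n false ∷ V
  monotone∉V : ∀ b → All (monotone n b ≢_) V
  monotone∉V b = All.tabulate λ y∈V eq →
    monotone-not-onCycle b 2≤k k<n (subst (OnCycle n k) (sym eq) (proj₂ (proj₁ (V-enum _) y∈V)))
  L-unique : Unique L
  L-unique = (ascending≢descending (<-trans 2≤k k<n) All.∷ monotone∉V true)
           ∷ monotone∉V false ∷ V-unique
  L⊆W : L ⊆ W
  L⊆W (here refl)         = proj₂ (W-enum _) (monotone-isPerm n true , monotone-onClosedWalk true 0<k)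
  L⊆W (there (here refl)) = proj₂ (W-enum _) (monotone-isPerm n false , monotone-onClosedWalk false 0<k)
  L⊆W (there (there y∈V)) = let (y-perm , y-onCycle) = proj₁ (V-enum _) y∈V in
    proj₂ (W-enum _) (y-perm , onCycle⇒onClosedWalk y-onCycle)
  W⊆L : W ⊆ L
  W⊆L {y} y∈W with proj₁ (W-enum y) y∈W
  ... | y-perm , y-onWalk with onClosedWalk⇒monotone⊎onCycle k-prime k<n y-onWalk
  ...   | inj₁ refl               = here refl
  ...   | inj₂ (inj₁ refl)        = there (here refl)
  ...   | inj₂ (inj₂ y-onCycle)   = there (there (proj₂ (V-enum y) (y-perm , y-onCycle)))
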